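{- For every unleveled context stack $\Delta$ and unleveled type $A$, the judgment $\Delta\vdash A$ is derivable in the unleveled Fitch-style calculus if and only if there exist a level $l$, a leveled context stack $\Delta'$ and a leveled type $A'$ such that $\Delta'\vdash^l A'$ is derivable in $\lambda^\Box$, $|\Delta'| = \Delta$ and $|A'| = A$.
   Context: Leveled calculus $\lambda^\Box$: levels are natural numbers; types of level $l$ are base types $\iota^l$, $A^l\to B^l$, and (for $l\ge1$) $\Box A^{l-1}$. A context of level $l$ is a list of variable declarations of level-$l$ types; a context stack of level $l$ is a sequence $\Gamma^{l+n-1};\dots;\Gamma^l$ ($n\ge0$) with levels decreasing by one from left to right. Rules: (Var) if $x:A\in\Gamma^l$ then $\Delta^{l+1};\Gamma^l\vdash^l x:A$; (Abs) from $\Delta^{l+1};\Gamma^l,x:A\vdash^l M:B$ infer $\Delta^{l+1};\Gamma^l\vdash^l\lambda x.M:A\to B$; (App) from $\Delta^l\vdash^l M:A\to B$ and $\Delta^l\vdash^l N:A$ infer $\Delta^l\vdash^l MN:B$; (Quo) from $\Delta^{l+1};\cdot\vdash^l M:A$ infer $\Delta^{l+1}\vdash^{l+1}\grave{}M:\Box A$; (Unq) from $\Delta^{l+1}\vdash^{l+1}M:\Box A$ infer $\Delta^{l+1};\Gamma^l\vdash^l{,}M:A$ for any context $\Gamma^l$. The unleveled Fitch-style calculus has types $\iota\mid A\to B\mid\Box A$, contexts and context stacks (sequences of contexts separated by semicolons) without levels, judgments $\Delta\vdash M:A$, and the same five rules with all level annotations erased. For each unleveled base type $\iota$ and level $l$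 there is a leveled base type $\iota^l$; the forgetful function $|\cdot|$ erases levels ($|\iota^l|=\iota$, homomorphically on types, contexts and stacks). $\Delta\vdash A$ means some term of type $A$ is derivable. -}

module Defs where

open import Data.Nat using (ℕ; suc)
open import Data.Product using (_×_; _,_; ∃)
open import Data.List using (List; []; _∷_; map)
open import Data.List.Membership.Propositional using (_∈_)

Name : Set
Name = ℕ

BaseName : Set
BaseName = ℕ

data Tm : Set where
  var : Name → Tm
  lam : Name → Tm → Tm
  app : Tm → Tm → Tm
  quo : Tm → Tm
  unq : Tm → Tm

data Ty : Set where
  ι   : BaseName → Ty
  _⇒_ : Ty → Ty → Ty
  □   : Ty → Ty

Ctx : Set
Ctx = List (Name × Ty)

data Stack : Set where
  ε   : Stack
  _︔_ : Stack → Ctx → Stack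

data _⊢_∶_ : Stack → Tm → Ty → Set where
  Var : ∀ {Δ Γ x A} → (x , A) ∈ Γ → (Δ ︔ Γ) ⊢ var x ∶ A
  Abs : ∀ {Δ Γ x A B M} → (Δ ︔ ((x , A) ∷ Γ)) ⊢ M ∶ B → (Δ ︔ Γ) ⊢ lam x M ∶ (A ⇒ B)
  App : ∀ {Δ A B M N} → Δ ⊢ M ∶ (A ⇒ B) → Δ ⊢ N ∶ A → Δ ⊢ app M N ∶ B
  Quo : ∀ {Δ A M} → (Δ ︔ []) ⊢ M ∶ A → Δ ⊢ quo M ∶ □ A
  Unq : ∀ {Δ Γ A M} → Δ ⊢ M ∶ □ A → (Δ ︔ Γ) ⊢ unq M ∶ A

_⊢_ : Stack → Ty → Set
Δ ⊢ A = ∃ λ M → Δ ⊢ M ∶ A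

data LTy : ℕ → Set where
  ι   : ∀ {l} → BaseName → LTy l
  _⇒_ : ∀ {l} → LTy l → LTy l → LTy l
  □   : ∀ {l} → LTy l → LTy (suc l)

LCtx : ℕ → Set
LCtx l = List (Name × LTy l)

-- LStack l : context stacks Γ^{l+n-1};…;Γ^l of level l (n ≥ 0)
data LStack : ℕ → Set where
  ε   : ∀ {l} → LStack l
  _︔_ : ∀ {l} → LStack (suc l) → LCtx l → LStack l

data _⊢[_]_∶_ : ∀ {l} → LStack l → (l′ : ℕ) → Tm → LTy l′ → Set where
  lVar : ∀ {l} {Δ : LStack (suc l)} {Γ : LCtx l} {x A}
      → (x , A) ∈ Γ → (Δ ︔ Γ) ⊢[ l ] var x ∶ A
  lAbs : ∀ {l} {Δ : LStack (suc l)} {Γ : LCtx l} {x} {A B : LTy l} {M}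
      → (Δ ︔ ((x , A) ∷ Γ)) ⊢[ l ] M ∶ B → (Δ ︔ Γ) ⊢[ l ] lam x M ∶ (A ⇒ B)
  lApp : ∀ {l} {Δ : LStack l} {A B : LTy l} {M N}
      → Δ ⊢[ l ] M ∶ (A ⇒ B) → Δ ⊢[ l ] N ∶ A → Δ ⊢[ l ] app M N ∶ B
  lQuo : ∀ {l} {Δ : LStack (suc l)} {A : LTy l} {M}
      → (Δ ︔ []) ⊢[ l ] M ∶ A → Δ ⊢[ suc l ] quo M ∶ □ A
  lUnq : ∀ {l} {Δ : LStack (suc l)} {Γ : LCtx l} {A : LTy l} {M}
      → Δ ⊢[ suc l ] M ∶ □ A → (Δ ︔ Γ) ⊢[ l ] unq M ∶ A

_⊢[_]_ : ∀ {l} → LStack l → (l′ : ℕ) → LTy l′ → Set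
Δ ⊢[ l ] A = ∃ λ M → Δ ⊢[ l ] M ∶ A

∣_∣ty : ∀ {l} → LTy l → Ty
∣ ι b ∣ty   = ι b
∣ A ⇒ B ∣ty = ∣ A ∣ty ⇒ ∣ B ∣ty
∣ □ A ∣ty   = □ ∣ A ∣ty

∣_∣ctx : ∀ {l} → LCtx l → Ctx
∣_∣ctx = map (λ { (x , A) → x , ∣ A ∣ty })

∣_∣st : ∀ {l} → LStack l → Stack
∣ ε ∣st     = ε
∣ Δ ︔ Γ ∣st = ∣ Δ ∣st ︔ ∣ Γ ∣ctx

-- Erasing levels sends λ^□ derivations to Fitch-style derivations rule by rule.
-- Conversely, annotate every type in the context at stack position i (counted
-- from the right) and in the conclusion with the levels l + i and l; each rule
-- of the Fitch-style calculus then becomes the corresponding leveled rule as soon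
-- as l is large enough for every quotation to find a positive level.  For l also
-- above the modal depth of Δ and A this annotation erases back to Δ and A.
module Submission where

open import Defs
open import Data.Nat using (ℕ; zero; suc; _≤_; _⊔_; s≤s)
open import Data.Nat.Properties using (≤-refl; ≤-trans; m≤m⊔n; m≤n⊔m; m≤n⇒m≤1+n)
open import Data.Product using (Σ; _×_; _,_; ∃)
open import Data.List using ([]; _∷_; map)
open import Data.List.Membership.Propositional using (_∈_)
open import Data.List.Membership.Propositional.Properties using (∈-map⁺)
open import Function.Bundles using (_⇔_; mk⇔)
open import Relation.Binary.PropositionalEquality using (_≡_; refl; cong; cong₂)

module Eventually where

  Eventually : (ℕ → Set) → Set
  Eventually P = ∃ λ N → ∀ l → N ≤ l → P l

  variable
    P Q R : ℕ → Set

  always : (∀ l → P l) → Eventually P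
  always p = 0 , λ l _ → p l

  map⁺ : (∀ {l} → P l → Q l) → Eventually P → Eventually Q
  map⁺ f (N , p) = N , λ l N≤l → f (p l N≤l)

  zipWith : (∀ {l} → P l → Q l → R l) → Eventually P → Eventually Q → Eventually R
  zipWith f (M , p) (N , q) = M ⊔ N , λ l M⊔N≤l →
    f (p l (≤-trans (m≤m⊔n M N) M⊔N≤l)) (q l (≤-trans (m≤n⊔m M N) M⊔N≤l))

  suc⁺ : Eventually P → Eventually (λ l → P (suc l))
  suc⁺ (N , p) = N , λ l N≤l → p (suc l) (m≤n⇒m≤1+n N≤l)

  pred⁺ : (∀ {l} → P l → Q (suc l)) → Eventually P → Eventually Q
  pred⁺ f (N , p) = suc N , λ { (suc l) (s≤s N≤l) → f (p l N≤l) }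

  witness : Eventually P → ∃ P
  witness (N , p) = N , p N ≤-refl

open Eventually

∣∣ctx-∈ : ∀ {l} {Γ : LCtx l} {x A} → (x , A) ∈ Γ → (x , ∣ A ∣ty) ∈ ∣ Γ ∣ctx
∣∣ctx-∈ = ∈-map⁺ λ { (x , A) → x , ∣ A ∣ty }

∣∣-⊢ : ∀ {l} {Δ : LStack l} {l′ M} {A : LTy l′} → Δ ⊢[ l′ ] M ∶ A → ∣ Δ ∣st ⊢ M ∶ ∣ A ∣ty
∣∣-⊢ (lVar x∈Γ) = Var (∣∣ctx-∈ x∈Γ)
∣∣-⊢ (lAbs d)   = Abs (∣∣-⊢ d)
∣∣-⊢ (lApp d e) = App (∣∣-⊢ d) (∣∣-⊢ e)
∣∣-⊢ (lQuo d)   = Quo (∣∣-⊢ d)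
∣∣-⊢ (lUnq d)   = Unq (∣∣-⊢ d)

liftTy : (l : ℕ) → Ty → LTy l
liftTy l       (ι b)   = ι b
liftTy l       (A ⇒ B) = liftTy l A ⇒ liftTy l B
liftTy (suc l) (□ A)   = □ (liftTy l A)
-- Junk value: level 0 has no boxed types.  It only occurs below the modal depth,
-- which the levels chosen by lift-⊢ and ∣∣-liftTy avoid.
liftTy zero    (□ A)   = ι 0

liftCtx : (l : ℕ) → Ctx → LCtx l
liftCtx l = map λ { (x , A) → x , liftTy l A }

liftSt : (l : ℕ) → Stack → LStack l
liftSt l ε       = ε
liftSt l (Δ ︔ Γ) = liftSt (suc l) Δ ︔ liftCtx l Γ

lift-⊢ : ∀ {Δ M A} → Δ ⊢ M ∶ A → Eventually (λ l → liftSt l Δ ⊢[ l ] M ∶ liftTy l A)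
lift-⊢ (Var x∈Γ) = always λ l → lVar (∈-map⁺ (λ { (y , B) → y , liftTy l B }) x∈Γ)
lift-⊢ (Abs d)   = map⁺ lAbs (lift-⊢ d)
lift-⊢ (App d e) = zipWith lApp (lift-⊢ d) (lift-⊢ e)
lift-⊢ (Quo d)   = pred⁺ lQuo (lift-⊢ d)
lift-⊢ (Unq d)   = map⁺ lUnq (suc⁺ (lift-⊢ d))

∣∣-liftTy : ∀ A → Eventually (λ l → ∣ liftTy l A ∣ty ≡ A)
∣∣-liftTy (ι b)   = always λ _ → refl
∣∣-liftTy (A ⇒ B) = zipWith (cong₂ _⇒_) (∣∣-liftTy A) (∣∣-liftTy B)
∣∣-liftTy (□ A)   = pred⁺ (cong □) (∣∣-liftTy A)

∣∣-liftCtx : ∀ Γ → Eventually (λ l → ∣ liftCtx l Γ ∣ctx ≡ Γ)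
∣∣-liftCtx []            = always λ _ → refl
∣∣-liftCtx ((x , A) ∷ Γ) =
  zipWith (λ eA eΓ → cong₂ _∷_ (cong (x ,_) eA) eΓ) (∣∣-liftTy A) (∣∣-liftCtx Γ)

∣∣-liftSt : ∀ Δ → Eventually (λ l → ∣ liftSt l Δ ∣st ≡ Δ)
∣∣-liftSt ε       = always λ _ → refl
∣∣-liftSt (Δ ︔ Γ) = zipWith (cong₂ _︔_) (suc⁺ (∣∣-liftSt Δ)) (∣∣-liftCtx Γ)

LeveledForm : Stack → Ty → Set
LeveledForm Δ A = Σ ℕ λ l → Σ (LStack l) λ Δ′ → Σ (LTy l) λ A′ →
                    (Δ′ ⊢[ l ] A′) × (∣ Δ′ ∣st ≡ Δ) × (∣ A′ ∣ty ≡ A)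

theorem2p2 : (Δ : Stack) (A : Ty) →
    (Δ ⊢ A) ⇔ (Σ ℕ λ l → Σ (LStack l) λ Δ′ → Σ (LTy l) λ A′ →
                 (Δ′ ⊢[ l ] A′) × (∣ Δ′ ∣st ≡ Δ) × (∣ A′ ∣ty ≡ A))
theorem2p2 Δ A = mk⇔ lift unlift
  where
  lift : Δ ⊢ A → LeveledForm Δ A
  lift (M , d) with witness (zipWith _,_ (lift-⊢ d) (zipWith _,_ (∣∣-liftSt Δ) (∣∣-liftTy A)))
  ... | l , d′ , ∣Δ′∣≡Δ , ∣A′∣≡A = l , liftSt l Δ , liftTy l A , (M , d′) , ∣Δ′∣≡Δ , ∣A′∣≡A

  unlift : LeveledForm Δ A → Δ ⊢ A
  unlift (l , Δ′ , A′ , (M , d) , refl , refl) = M , ∣∣-⊢ d
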